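{- Let $q>1$ be real. If $r$, $s$, $u$, $v$ are positive integers, then \begin{align*} \frac{1}{[u]_q^r[v]_q^s} &= \sum_{a=0}^{r-1}\sum_{b=0}^{r-1-a}\binom{a+s-1}{a,\, b}\frac{(1-q)^b q^{(s-1-b)u+av}}{[u]_q^{r-a-b}[u+v]_q^{s+a}} +\sum_{a=0}^{s-1}\sum_{b=0}^{s-1-a}\binom{a+r-1}{a,\, b}\frac{(1-q)^b q^{au+(r-1-b)v}}{[v]_q^{s-a-b}[u+v]_q^{r+a}}\\ &\quad-\sum_{j=1}^{\min(r,s)}\binom{r+s-j-1}{r-j,\, s-j}\frac{(1-q)^j q^{(s-j)u+(r-j)v}}{[u+v]_q^{r+s-j}}. \end{align*}
   Context: $[n]_q=(q^n-1)/(q-1)=\sum_{j=0}^{n-1}q^j$ for positive integers $n$. The trinomial coefficient is $\binom{z}{a,\,b}=\binom{z}{a}\binom{z-a}{b}$ for nonnegative integers $a,b$. -}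

module Defs where

open import Level using (Level)
open import Data.Nat as ℕ using (ℕ; zero; suc)
open import Data.Nat.Combinatorics using (_C_)
open import Algebra.Bundles using (CommutativeRing)

trinom : ℕ → ℕ → ℕ → ℕ
trinom z a b = (z C a) ℕ.* ((z ℕ.∸ a) C b)

module Over {c ℓ : Level} (R : CommutativeRing c ℓ) where
  open CommutativeRing R public

  pow : Carrier → ℕ → Carrier
  pow x zero    = 1#
  pow x (suc n) = x * pow x n

  fromℕ : ℕ → Carrier
  fromℕ zero    = 0#
  fromℕ (suc n) = 1# + fromℕ n

  sumTo : ℕ → (ℕ → Carrier) → Carrier
  sumTo zero    f = 0#
  sumTo (suc n) f = sumTo n f + f n

  qint : Carrier → ℕ → Carrier
  qint q n = sumTo n (pow q)

{-# OPTIONS --safe #-}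
module Submission where

-- With x = 1/[u]_q, y = 1/[v]_q, w = 1/[u+v]_q, P = q^u, Q = q^v and δ = 1 − q, the identities
-- (1 − q)[n]_q + q^n = 1 and [u+v]_q = [v]_q + q^v [u]_q give P x + δ = x, Q y + δ = y and
-- x y = w (x + Q y), hence x y = P w x + Q w y + δ w.  Multiplying by x^r y^s shows that
-- F(r, s) = x^r y^s satisfies F(r+1, s+1) = P w F(r+1, s) + Q w F(r, s+1) + δ w F(r, s).
-- Pascal-type identities for the trinomial coefficients show that the right-hand side of the
-- theorem satisfies the same recurrence, and for s = 1 (or r = 1) both sides agree by a geometric
-- expansion of x^r y.

open import Defs
open import Level using (Level)
open import Data.Nat as ℕ using (ℕ; _⊓_)
open import Data.Nat.Base using (zero; suc)
open import Algebra.Bundles using (CommutativeRing)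

module Coefficients where
  open import Data.Nat
  open import Data.Nat.Properties
  open import Data.Nat.Combinatorics
  open import Data.Nat.DivMod using (m/n*n≡m)
  open import Relation.Nullary using (yes; no)
  open import Relation.Binary.PropositionalEquality
  open import Data.Nat.Tactic.RingSolver using (solve-∀)
  open ≡-Reasoning

  shift : (ℕ → ℕ) → ℕ → ℕ
  shift f zero    = 0
  shift f (suc n) = f n

  *-shift : ∀ m f n → shift (λ k → m * f k) n ≡ m * shift f n
  *-shift m f zero    = sym (*-zeroʳ m)
  *-shift m f (suc n) = refl

  [n+1]Ck≡nCk+shift : ∀ n k → suc n C k ≡ n C k + shift (n C_) k
  [n+1]Ck≡nCk+shift n zero    = refl
  [n+1]Ck≡nCk+shift n (suc k) = trans (sym (nCk+nC[k+1]≡[n+1]C[k+1] n k)) (+-comm (n C k) _)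

  nCk*k!m!≡n! : ∀ {n} k m → k + m ≡ n → (n C k) * (k ! * m !) ≡ n !
  nCk*k!m!≡n! {n} k m refl = begin
    (n C k) * (k ! * m !)           ≡⟨ cong (λ j → (n C k) * (k ! * j !)) (sym (m+n∸m≡n k m)) ⟩
    (n C k) * (k ! * (n ∸ k) !)     ≡⟨ cong (_* (k ! * (n ∸ k) !)) (nCk≡n!/k![n-k]! k≤n) ⟩
    n ! / (k ! * (n ∸ k) !) * (k ! * (n ∸ k) !) ≡⟨ m/n*n≡m (k![n∸k]!∣n! k≤n) ⟩
    n !                             ∎
    where
    k≤n : k ≤ n
    k≤n = m≤m+n k m
    instance _ = k !* (n ∸ k) !≢0

  coeffG : ℕ → ℕ → ℕ → ℕ
  coeffG t a b = ((a + t) C a) * (t C b)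

  trinom≡coeffG : ∀ t a b → trinom (a + suc t ∸ 1) a b ≡ coeffG t a b
  trinom≡coeffG t a b rewrite +-suc a t | m+n∸m≡n a t = refl

  coeffG-vanish : ∀ {t b} a → t < b → coeffG t a b ≡ 0
  coeffG-vanish {t} a t<b = trans (cong (((a + t) C a) *_) (k>n⇒nCk≡0 t<b)) (*-zeroʳ ((a + t) C a))

  coeffG-pascal : ∀ t a b →
    coeffG (suc t) a b ≡ coeffG t a b + shift (coeffG t a) b + shift (λ a → coeffG (suc t) a b) a
  coeffG-pascal t zero b = begin
    1 * (suc t C b)                       ≡⟨ cong (1 *_) ([n+1]Ck≡nCk+shift t b) ⟩
    1 * (t C b + shift (t C_) b)          ≡⟨ split (t C b) (shift (t C_) b) ⟩
    1 * (t C b) + 1 * shift (t C_) b + 0  ≡⟨ cong (λ x → 1 * (t C b) + x + 0) (*-shift 1 (t C_) b) ⟨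
    1 * (t C b) + shift (λ k → 1 * (t C k)) b + 0 ∎
    where
    split : ∀ x y → 1 * (x + y) ≡ 1 * x + 1 * y + 0
    split = solve-∀
  coeffG-pascal t (suc a) b = begin
    (suc (a + suc t) C suc a) * (suc t C b)
      ≡⟨ cong₂ _*_ (sym (nCk+nC[k+1]≡[n+1]C[k+1] (a + suc t) a)) ([n+1]Ck≡nCk+shift t b) ⟩
    (Y + (a + suc t) C suc a) * (p + q)
      ≡⟨ cong (λ n → (Y + n C suc a) * (p + q)) (+-suc a t) ⟩
    (Y + X) * (p + q)
      ≡⟨ distribute Y X p q ⟩
    X * p + X * q + Y * (p + q)
      ≡⟨ cong₂ (λ u v → X * p + u + Y * v) (*-shift X (t C_) b) ([n+1]Ck≡nCk+shift t b) ⟨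
    X * p + shift (λ k → X * (t C k)) b + Y * (suc t C b) ∎
    where
    X Y p q : ℕ
    X = suc (a + t) C suc a
    Y = (a + suc t) C a
    p = t C b
    q = shift (t C_) b
    distribute : ∀ y x p q → (y + x) * (p + q) ≡ x * p + x * q + y * (p + q)
    distribute = solve-∀

  coeffG[0,a,0]≡1 : ∀ a → coeffG 0 a 0 ≡ 1
  coeffG[0,a,0]≡1 a = trans (cong (λ n → (n C a) * 1) (+-identityʳ a)) (cong (_* 1) (nCn≡1 a))

  coeffD : ℕ → ℕ → ℕ → ℕ
  coeffD r s i = (r C i) * ((r + s ∸ i) C r)

  coeffD[r,0,0]≡1 : ∀ r → coeffD r 0 0 ≡ 1
  coeffD[r,0,0]≡1 r = trans (cong (λ n → 1 * (n C r)) (+-identityʳ r)) (cong (1 *_) (nCn≡1 r))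

  coeffD-vanishˡ : ∀ {r i} s → r < i → coeffD r s i ≡ 0
  coeffD-vanishˡ {r} {i} s r<i = cong (_* ((r + s ∸ i) C r)) (k>n⇒nCk≡0 r<i)

  coeffD-vanishʳ : ∀ {s i} r → s < i → coeffD r s i ≡ 0
  coeffD-vanishʳ {s} {i} r s<i with i ≤? r
  ... | no i≰r  = coeffD-vanishˡ s (≰⇒> i≰r)
  ... | yes i≤r = trans (cong ((r C i) *_) (k>n⇒nCk≡0 r+s∸i<r)) (*-zeroʳ (r C i))
    where
    r+s∸i<r : r + s ∸ i < r
    r+s∸i<r = <-≤-trans (∸-monoʳ-< s<i (m≤n⇒m≤n+o s i≤r)) (≤-reflexive (m+n∸n≡m r s))

  coeffD-pascal : ∀ p t i →
    coeffD (suc p) (suc t) i ≡ coeffD (suc p) t i + coeffD p (suc t) i + shift (coeffD p t) i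
  coeffD-pascal p t i with i ≤? suc p
  ... | no i≰1+p = begin
    coeffD (suc p) (suc t) i        ≡⟨ coeffD-vanishˡ (suc t) 1+p<i ⟩
    0                               ≡⟨ shift-vanish i 1+p<i ⟩
    0 + 0 + shift (coeffD p t) i
      ≡⟨ cong₂ (λ x y → x + y + shift (coeffD p t) i) (coeffD-vanishˡ t 1+p<i) (coeffD-vanishˡ (suc t) p<i) ⟨
    coeffD (suc p) t i + coeffD p (suc t) i + shift (coeffD p t) i ∎
    where
    1+p<i : suc p < i
    1+p<i = ≰⇒> i≰1+p
    p<i : p < i
    p<i = <-trans (n<1+n p) 1+p<i
    shift-vanish : ∀ i → suc p < i → 0 ≡ 0 + 0 + shift (coeffD p t) i
    shift-vanish (suc j) (s≤s p<j) = sym (coeffD-vanishˡ t p<j)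
  ... | yes i≤1+p = begin
    (suc p C i) * ((suc p + suc t ∸ i) C suc p)
      ≡⟨ cong (λ n → (suc p C i) * (n C suc p)) (+-∸-assoc 1 i≤p+1+t) ⟩
    (suc p C i) * (suc N C suc p)
      ≡⟨ cong₂ _*_ ([n+1]Ck≡nCk+shift p i) (sym (nCk+nC[k+1]≡[n+1]C[k+1] N p)) ⟩
    (p C i + shift (p C_) i) * (N C p + N C suc p)
      ≡⟨ distribute (p C i) (shift (p C_) i) (N C p) (N C suc p) ⟩
    (p C i + shift (p C_) i) * (N C suc p) + (p C i) * (N C p) + shift (p C_) i * (N C p)
      ≡⟨ cong₂ (λ x z → x * (N C suc p) + (p C i) * (N C p) + z) ([n+1]Ck≡nCk+shift p i) (sym (shift-coeffD i)) ⟨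
    (suc p C i) * (N C suc p) + (p C i) * (N C p) + shift (coeffD p t) i
      ≡⟨ cong (λ m → (suc p C i) * ((m ∸ i) C suc p) + (p C i) * (N C p) + shift (coeffD p t) i) (+-suc p t) ⟩
    (suc p C i) * ((suc p + t ∸ i) C suc p) + (p C i) * (N C p) + shift (coeffD p t) i ∎
    where
    N : ℕ
    N = p + suc t ∸ i
    i≤p+1+t : i ≤ p + suc t
    i≤p+1+t = ≤-trans i≤1+p (≤-trans (s≤s (m≤m+n p t)) (≤-reflexive (sym (+-suc p t))))
    distribute : ∀ a b x y → (a + b) * (x + y) ≡ (a + b) * y + a * x + b * x
    distribute = solve-∀
    shift-coeffD : ∀ i → shift (p C_) i * ((p + suc t ∸ i) C p) ≡ shift (coeffD p t) i
    shift-coeffD zero    = refl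
    shift-coeffD (suc j) = cong (λ n → (p C j) * ((n ∸ suc j) C p)) (+-suc p t)

  trinom*a!b!c!≡n! : ∀ a b c → trinom (a + b + c) a b * (a ! * b ! * c !) ≡ (a + b + c) !
  trinom*a!b!c!≡n! a b c = begin
    ((n C a) * ((n ∸ a) C b)) * (a ! * b ! * c !)
      ≡⟨ cong (λ m → ((n C a) * (m C b)) * (a ! * b ! * c !)) n∸a≡b+c ⟩
    ((n C a) * ((b + c) C b)) * (a ! * b ! * c !)
      ≡⟨ regroup (n C a) ((b + c) C b) (a !) (b !) (c !) ⟩
    (n C a) * (a ! * (((b + c) C b) * (b ! * c !)))
      ≡⟨ cong (λ m → (n C a) * (a ! * m)) (nCk*k!m!≡n! b c refl) ⟩
    (n C a) * (a ! * (b + c) !)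
      ≡⟨ nCk*k!m!≡n! a (b + c) (sym (+-assoc a b c)) ⟩
    n ! ∎
    where
    n : ℕ
    n = a + b + c
    n∸a≡b+c : n ∸ a ≡ b + c
    n∸a≡b+c = trans (cong (_∸ a) (+-assoc a b c)) (m+n∸m≡n a (b + c))
    regroup : ∀ x y fa fb fc → x * y * (fa * fb * fc) ≡ x * (fa * (y * (fb * fc)))
    regroup = solve-∀

  a+i+[b+i]∸i≡a+b+i : ∀ a b i → a + i + (b + i) ∸ i ≡ a + b + i
  a+i+[b+i]∸i≡a+b+i a b i = trans (cong (_∸ i) (reorder a b i)) (m+n∸n≡m (a + b + i) i)
    where
    reorder : ∀ a b i → a + i + (b + i) ≡ a + b + i + i
    reorder = solve-∀

  coeffD*a!b!i!≡n! : ∀ a b i → coeffD (a + i) (b + i) i * (a ! * b ! * i !) ≡ (a + b + i) !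
  coeffD*a!b!i!≡n! a b i = begin
    ((a + i) C i) * ((a + i + (b + i) ∸ i) C (a + i)) * (a ! * b ! * i !)
      ≡⟨ cong (λ m → ((a + i) C i) * (m C (a + i)) * (a ! * b ! * i !)) (a+i+[b+i]∸i≡a+b+i a b i) ⟩
    ((a + i) C i) * (n C (a + i)) * (a ! * b ! * i !)
      ≡⟨ regroup ((a + i) C i) (n C (a + i)) (a !) (b !) (i !) ⟩
    (n C (a + i)) * ((((a + i) C i) * (i ! * a !)) * b !)
      ≡⟨ cong (λ m → (n C (a + i)) * (m * b !)) (nCk*k!m!≡n! i a (+-comm i a)) ⟩
    (n C (a + i)) * ((a + i) ! * b !)
      ≡⟨ nCk*k!m!≡n! (a + i) b (swap a b i) ⟩
    n ! ∎
    where
    n : ℕ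
    n = a + b + i
    regroup : ∀ x y fa fb fi → x * y * (fa * fb * fi) ≡ y * ((x * (fi * fa)) * fb)
    regroup = solve-∀
    swap : ∀ a b i → a + i + b ≡ a + b + i
    swap = solve-∀

  trinom≡coeffD : ∀ a b i → trinom (a + b + i) a b ≡ coeffD (a + i) (b + i) i
  trinom≡coeffD a b i = *-cancelʳ-≡ _ _ (a ! * b ! * i !) {{a!b!i!≢0}}
    (trans (trinom*a!b!c!≡n! a b i) (sym (coeffD*a!b!i!≡n! a b i)))
    where
    a!b!i!≢0 : NonZero (a ! * b ! * i !)
    a!b!i!≢0 = m*n≢0 (a ! * b !) (i !) {{m*n≢0 (a !) (b !) {{a !≢0}} {{b !≢0}}}} {{i !≢0}}

  trinom≡coeffD′ : ∀ {r s i} → i ≤ r → i ≤ s → trinom (r + s ∸ i) (r ∸ i) (s ∸ i) ≡ coeffD r s i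
  trinom≡coeffD′ {r} {s} {i} i≤r i≤s =
    subst₂ (λ r s → trinom (r + s ∸ i) (r ∸ i) (s ∸ i) ≡ coeffD r s i) (m∸n+n≡m i≤r) (m∸n+n≡m i≤s)
           (shifted (r ∸ i) (s ∸ i))
    where
    shifted : ∀ a b → trinom (a + i + (b + i) ∸ i) (a + i ∸ i) (b + i ∸ i) ≡ coeffD (a + i) (b + i) i
    shifted a b = begin
      trinom (a + i + (b + i) ∸ i) (a + i ∸ i) (b + i ∸ i)
        ≡⟨ cong (λ n → trinom n (a + i ∸ i) (b + i ∸ i)) (a+i+[b+i]∸i≡a+b+i a b i) ⟩
      trinom (a + b + i) (a + i ∸ i) (b + i ∸ i)
        ≡⟨ cong₂ (trinom (a + b + i)) (m+n∸n≡m a i) (m+n∸n≡m b i) ⟩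
      trinom (a + b + i) a b
        ≡⟨ trinom≡coeffD a b i ⟩
      coeffD (a + i) (b + i) i ∎

  r+[1+s]∸i≡1+[r+s∸i] : ∀ {r s i} → i ≤ r + s → r + suc s ∸ i ≡ suc (r + s ∸ i)
  r+[1+s]∸i≡1+[r+s∸i] {r} {s} {i} i≤r+s = trans (cong (_∸ i) (+-suc r s)) (+-∸-assoc 1 i≤r+s)

open Coefficients

module Arithmetic {c ℓ : Level} (R : CommutativeRing c ℓ) where
  open Over R
  import Data.Nat.Properties as ℕ
  open import Relation.Binary.PropositionalEquality as ≡ using (_≡_)
  open import Relation.Nullary using (yes; no)
  open import Algebra.Properties.Semiring.Exp semiring using (_^_; ^-homo-*; ^-assocʳ)
  open import Algebra.Properties.Semiring.Mult semiring using (_×_; ×-homo-+)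
  open import Algebra.Properties.CommutativeSemigroup *-commutativeSemigroup using (x∙yz≈y∙xz)
  open import Algebra.Solver.Ring.NaturalCoefficients.Default commutativeSemiring
  open import Relation.Binary.Reasoning.Setoid setoid

  pow≡^ : ∀ x n → pow x n ≡ x ^ n
  pow≡^ x zero    = ≡.refl
  pow≡^ x (suc n) = ≡.cong (x *_) (pow≡^ x n)

  pow-+ : ∀ x m n → pow x (m ℕ.+ n) ≈ pow x m * pow x n
  pow-+ x m n rewrite pow≡^ x (m ℕ.+ n) | pow≡^ x m | pow≡^ x n = ^-homo-* x m n

  pow-* : ∀ x m n → pow x (m ℕ.* n) ≈ pow (pow x n) m
  pow-* x m n rewrite pow≡^ x (m ℕ.* n) | pow≡^ (pow x n) m | pow≡^ x n | ℕ.*-comm m n = sym (^-assocʳ x n m)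

  fromℕ≡× : ∀ n → fromℕ n ≡ n × 1#
  fromℕ≡× zero    = ≡.refl
  fromℕ≡× (suc n) = ≡.cong (1# +_) (fromℕ≡× n)

  fromℕ-+ : ∀ m n → fromℕ (m ℕ.+ n) ≈ fromℕ m + fromℕ n
  fromℕ-+ m n rewrite fromℕ≡× (m ℕ.+ n) | fromℕ≡× m | fromℕ≡× n = ×-homo-+ 1# m n

  fromℕ≈1 : ∀ {k} → k ≡ 1 → fromℕ k ≈ 1#
  fromℕ≈1 ≡.refl = +-identityʳ 1#

  zero-coefficient : ∀ {k} M → k ≡ 0 → fromℕ k * M ≈ 0#
  zero-coefficient M ≡.refl = zeroˡ M

  pull-factor : ∀ x {M N} y → M ≈ y * N → x * M ≈ y * (x * N)
  pull-factor x y M≈yN = trans (*-congˡ M≈yN) (x∙yz≈y∙xz x y _)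

  pull-factor-vanishing : ∀ {k} M N y → k ≡ 0 → fromℕ k * M ≈ y * (fromℕ k * N)
  pull-factor-vanishing M N y k≡0 =
    trans (zero-coefficient M k≡0) (sym (trans (*-congˡ (zero-coefficient N k≡0)) (zeroʳ y)))

  coefficient-split : ∀ {k} l m n M → k ≡ l ℕ.+ m ℕ.+ n →
                      fromℕ k * M ≈ fromℕ l * M + fromℕ m * M + fromℕ n * M
  coefficient-split l m n M ≡.refl = begin
    fromℕ (l ℕ.+ m ℕ.+ n) * M                  ≈⟨ *-congʳ (trans (fromℕ-+ (l ℕ.+ m) n) (+-congʳ (fromℕ-+ l m))) ⟩
    (fromℕ l + fromℕ m + fromℕ n) * M          ≈⟨ trans (distribʳ M _ _) (+-congʳ (distribʳ M _ _)) ⟩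
    fromℕ l * M + fromℕ m * M + fromℕ n * M    ∎

  sumTo-cong : ∀ n {f g : ℕ → Carrier} → (∀ i → f i ≈ g i) → sumTo n f ≈ sumTo n g
  sumTo-cong zero    f≈g = refl
  sumTo-cong (suc n) f≈g = +-cong (sumTo-cong n f≈g) (f≈g n)

  sumTo-cong-< : ∀ n {f g : ℕ → Carrier} → (∀ i → i ℕ.< n → f i ≈ g i) → sumTo n f ≈ sumTo n g
  sumTo-cong-< zero    f≈g = refl
  sumTo-cong-< (suc n) f≈g =
    +-cong (sumTo-cong-< n (λ i i<n → f≈g i (ℕ.m<n⇒m<1+n i<n))) (f≈g n (ℕ.n<1+n n))

  sumTo-vanish : ∀ n {f : ℕ → Carrier} → (∀ i → f i ≈ 0#) → sumTo n f ≈ 0#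
  sumTo-vanish zero    f≈0 = refl
  sumTo-vanish (suc n) f≈0 = trans (+-cong (sumTo-vanish n f≈0) (f≈0 n)) (+-identityʳ 0#)

  sumTo-+ : ∀ n (f g : ℕ → Carrier) → sumTo n (λ i → f i + g i) ≈ sumTo n f + sumTo n g
  sumTo-+ zero    f g = sym (+-identityʳ 0#)
  sumTo-+ (suc n) f g = trans (+-congʳ (sumTo-+ n f g)) (interchange _ _ _ _)
    where
    interchange : ∀ a b c d → (a + b) + (c + d) ≈ (a + c) + (b + d)
    interchange = solve 4 (λ a b c d → (a :+ b) :+ (c :+ d) := (a :+ c) :+ (b :+ d)) refl

  *-distribˡ-sumTo : ∀ n x (f : ℕ → Carrier) → x * sumTo n f ≈ sumTo n (λ i → x * f i)
  *-distribˡ-sumTo zero    x f = zeroʳ x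
  *-distribˡ-sumTo (suc n) x f = trans (distribˡ x _ _) (+-congʳ (*-distribˡ-sumTo n x f))

  sumTo-suc-head : ∀ n (f : ℕ → Carrier) → sumTo (suc n) f ≈ f 0 + sumTo n (λ i → f (suc i))
  sumTo-suc-head zero    f = trans (+-identityˡ _) (sym (+-identityʳ _))
  sumTo-suc-head (suc n) f = trans (+-congʳ (sumTo-suc-head n f)) (+-assoc _ _ _)

  sumTo-extend : ∀ {m} n (f : ℕ → Carrier) → m ℕ.≤ n → (∀ i → m ℕ.≤ i → i ℕ.< n → f i ≈ 0#) →
                 sumTo n f ≈ sumTo m f
  sumTo-extend zero f ℕ.z≤n tail≈0 = refl
  sumTo-extend {m} (suc n) f m≤n tail≈0 with m ℕ.≟ suc n
  ... | yes ≡.refl = refl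
  ... | no m≢n =
    trans (+-cong (sumTo-extend n f m≤n′ (λ i m≤i i<n → tail≈0 i m≤i (ℕ.m<n⇒m<1+n i<n)))
                  (tail≈0 n m≤n′ (ℕ.n<1+n n)))
          (+-identityʳ _)
    where
    m≤n′ : m ℕ.≤ n
    m≤n′ = ℕ.≤-pred (ℕ.≤∧≢⇒< m≤n m≢n)

  -- Opaque, so that a goal Tri r f ≈ Tri r g determines f and g by unification.
  opaque
    Tri : ℕ → (ℕ → ℕ → ℕ → Carrier) → Carrier
    Tri r f = sumTo r (λ a → sumTo (r ℕ.∸ a) (λ b → f a b (r ℕ.∸ a ℕ.∸ b)))

    Tri-cong : ∀ r {f g : ℕ → ℕ → ℕ → Carrier} → (∀ a b e → f a b e ≈ g a b e) → Tri r f ≈ Tri r g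
    Tri-cong r f≈g = sumTo-cong r (λ a → sumTo-cong (r ℕ.∸ a) (λ b → f≈g a b _))

    Tri-+ : ∀ r (f g : ℕ → ℕ → ℕ → Carrier) → Tri r (λ a b e → f a b e + g a b e) ≈ Tri r f + Tri r g
    Tri-+ r f g = trans (sumTo-cong r (λ a → sumTo-+ (r ℕ.∸ a) _ _)) (sumTo-+ r _ _)

    *-distribˡ-Tri : ∀ r x (f : ℕ → ℕ → ℕ → Carrier) → x * Tri r f ≈ Tri r (λ a b e → x * f a b e)
    *-distribˡ-Tri r x f = trans (*-distribˡ-sumTo r x _) (sumTo-cong r (λ a → *-distribˡ-sumTo (r ℕ.∸ a) x _))

    Tri-dropᵇ : ∀ r (f : ℕ → ℕ → ℕ → Carrier) → (∀ a e → f a 0 e ≈ 0#) →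
                Tri (suc r) f ≈ Tri r (λ a b → f a (suc b))
    Tri-dropᵇ r f f≈0 = begin
      Tri (suc r) f                   ≈⟨ sumTo-cong-< (suc r) (λ a a<1+r → column a (ℕ.≤-pred a<1+r)) ⟩
      sumTo r column′ + column′ r      ≈⟨ +-congˡ last-column ⟩
      sumTo r column′ + 0#             ≈⟨ +-identityʳ _ ⟩
      Tri r (λ a b → f a (suc b))      ∎
      where
      column′ : ℕ → Carrier
      column′ a = sumTo (r ℕ.∸ a) (λ b → f a (suc b) (r ℕ.∸ a ℕ.∸ b))
      column : ∀ a → a ℕ.≤ r → sumTo (suc r ℕ.∸ a) (λ b → f a b (suc r ℕ.∸ a ℕ.∸ b)) ≈ column′ a
      column a a≤r rewrite ℕ.+-∸-assoc 1 a≤r =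
        trans (sumTo-suc-head (r ℕ.∸ a) _) (trans (+-congʳ (f≈0 a _)) (+-identityˡ _))
      last-column : column′ r ≈ 0#
      last-column rewrite ℕ.n∸n≡0 r = refl

    Tri-dropᵃ : ∀ r (f : ℕ → ℕ → ℕ → Carrier) → (∀ b e → f 0 b e ≈ 0#) →
                Tri (suc r) f ≈ Tri r (λ a → f (suc a))
    Tri-dropᵃ r f f≈0 =
      trans (sumTo-suc-head r _) (trans (+-congʳ (sumTo-vanish (suc r) (λ b → f≈0 b _))) (+-identityˡ _))

    Tri-first-row : ∀ n (f : ℕ → ℕ → ℕ → Carrier) → (∀ a b e → f a (suc b) e ≈ 0#) →
                    Tri (suc n) f ≈ sumTo (suc n) (λ a → f a 0 (suc n ℕ.∸ a))
    Tri-first-row n f f≈0 = sumTo-cong-< (suc n) (λ a a<1+n → column a (ℕ.≤-pred a<1+n))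
      where
      column : ∀ a → a ℕ.≤ n →
               sumTo (suc n ℕ.∸ a) (λ b → f a b (suc n ℕ.∸ a ℕ.∸ b)) ≈ f a 0 (suc n ℕ.∸ a)
      column a a≤n rewrite ℕ.+-∸-assoc 1 a≤n =
        trans (sumTo-suc-head (n ℕ.∸ a) _) (trans (+-congˡ (sumTo-vanish (n ℕ.∸ a) (λ b → f≈0 a b _))) (+-identityʳ _))

    Tri-unfold : ∀ r (f : ℕ → ℕ → ℕ → Carrier) →
                 Tri r f ≈ sumTo r (λ a → sumTo (r ℕ.∸ a) (λ b → f a b (r ℕ.∸ a ℕ.∸ b)))
    Tri-unfold r f = refl

    Tri-one : ∀ (f : ℕ → ℕ → ℕ → Carrier) → Tri 1 f ≈ f 0 0 1
    Tri-one f = trans (+-identityˡ _) (+-identityˡ _)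

module QIntegers {c ℓ : Level} (R : CommutativeRing c ℓ) where
  open Over R
  open Arithmetic R using (pow-+)
  import Data.Nat.Properties as ℕ
  open import Relation.Binary.PropositionalEquality as ≡ using (_≡_)
  open import Algebra.Solver.Ring.NaturalCoefficients.Default commutativeSemiring
  open import Relation.Binary.Reasoning.Setoid setoid

  qint-telescope : ∀ q n → (1# - q) * qint q n + pow q n ≈ 1#
  qint-telescope q zero    = trans (+-congʳ (zeroʳ _)) (+-identityˡ 1#)
  qint-telescope q (suc n) = begin
    (1# - q) * (qint q n + pow q n) + q * pow q n   ≈⟨ regroup (1# - q) q (qint q n) (pow q n) ⟩
    (1# - q) * qint q n + ((1# - q) + q) * pow q n  ≈⟨ +-congˡ (*-congʳ 1-q+q≈1) ⟩
    (1# - q) * qint q n + 1# * pow q n              ≈⟨ +-congˡ (*-identityˡ _) ⟩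
    (1# - q) * qint q n + pow q n                   ≈⟨ qint-telescope q n ⟩
    1#                                              ∎
    where
    regroup : ∀ d q S t → d * (S + t) + q * t ≈ d * S + (d + q) * t
    regroup = solve 4 (λ d q S t → d :* (S :+ t) :+ q :* t := d :* S :+ (d :+ q) :* t) refl
    1-q+q≈1 : (1# - q) + q ≈ 1#
    1-q+q≈1 = trans (+-assoc _ _ _) (trans (+-congˡ (-‿inverseˡ q)) (+-identityʳ 1#))

  qint-+ : ∀ q m n → qint q (m ℕ.+ n) ≈ qint q m + pow q m * qint q n
  qint-+ q m zero rewrite ℕ.+-identityʳ m = sym (trans (+-congˡ (zeroʳ _)) (+-identityʳ _))
  qint-+ q m (suc n) rewrite ℕ.+-suc m n = begin
    qint q (m ℕ.+ n) + pow q (m ℕ.+ n)                       ≈⟨ +-cong (qint-+ q m n) (pow-+ q m n) ⟩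
    (qint q m + pow q m * qint q n) + pow q m * pow q n      ≈⟨ +-assoc _ _ _ ⟩
    qint q m + (pow q m * qint q n + pow q m * pow q n)      ≈⟨ +-congˡ (distribˡ _ _ _) ⟨
    qint q m + pow q m * (qint q n + pow q n)                ∎

  qⁿx+[1-q]≈x : ∀ q n x → qint q n * x ≈ 1# → pow q n * x + (1# - q) ≈ x
  qⁿx+[1-q]≈x q n x [n]x≈1 = begin
    pow q n * x + (1# - q)                       ≈⟨ +-congˡ (trans (sym (*-identityʳ _)) (*-congˡ (sym [n]x≈1))) ⟩
    pow q n * x + (1# - q) * (qint q n * x)      ≈⟨ regroup (pow q n) x (1# - q) (qint q n) ⟩
    ((1# - q) * qint q n + pow q n) * x          ≈⟨ *-congʳ (qint-telescope q n) ⟩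
    1# * x                                       ≈⟨ *-identityˡ x ⟩
    x                                            ∎
    where
    regroup : ∀ p x d U → p * x + d * (U * x) ≈ (d * U + p) * x
    regroup = solve 4 (λ p x d U → p :* x :+ d :* (U :* x) := (d :* U :+ p) :* x) refl

  xy≈w[x+qⁿy] : ∀ q m n x y w → qint q m * x ≈ 1# → qint q n * y ≈ 1# → qint q (m ℕ.+ n) * w ≈ 1# →
                x * y ≈ w * (x + pow q n * y)
  xy≈w[x+qⁿy] q m n x y w [m]x≈1 [n]y≈1 [m+n]w≈1 = begin
    x * y                                                ≈⟨ *-identityˡ _ ⟨
    1# * (x * y)                                         ≈⟨ *-congʳ (sym [m+n]w≈1) ⟩
    qint q (m ℕ.+ n) * w * (x * y)                       ≈⟨ *-congʳ (*-congʳ [m+n]≈[n]+qⁿ[m]) ⟩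
    (qint q n + pow q n * qint q m) * w * (x * y)        ≈⟨ regroup _ _ _ _ _ _ ⟩
    w * ((qint q n * y) * x + pow q n * ((qint q m * x) * y))
      ≈⟨ *-congˡ (+-cong (*-congʳ [n]y≈1) (*-congˡ (*-congʳ [m]x≈1))) ⟩
    w * (1# * x + pow q n * (1# * y))                    ≈⟨ *-congˡ (+-cong (*-identityˡ x) (*-congˡ (*-identityˡ y))) ⟩
    w * (x + pow q n * y)                                ∎
    where
    [m+n]≈[n]+qⁿ[m] : qint q (m ℕ.+ n) ≈ qint q n + pow q n * qint q m
    [m+n]≈[n]+qⁿ[m] = trans (reflexive (≡.cong (qint q) (ℕ.+-comm m n))) (qint-+ q n m)
    regroup : ∀ V Qn U w x y → (V + Qn * U) * w * (x * y) ≈ w * ((V * y) * x + Qn * ((U * x) * y))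
    regroup = solve 6 (λ V Qn U w x y → (V :+ Qn :* U) :* w :* (x :* y) := w :* ((V :* y) :* x :+ Qn :* ((U :* x) :* y))) refl

module Recurrences {c ℓ : Level} (R : CommutativeRing c ℓ) where
  open Over R
  open import Algebra.Solver.Ring.NaturalCoefficients.Default commutativeSemiring
  open import Relation.Binary.Reasoning.Setoid setoid

  Recurrence : Carrier → Carrier → Carrier → (ℕ → ℕ → Carrier) → Set ℓ
  Recurrence α β γ F = ∀ r s → F (suc r) (suc s) ≈ α * F (suc r) s + β * F r (suc s) + γ * F r s

  Recurrence-shiftˡ : ∀ {α β γ F} → Recurrence α β γ F → Recurrence α β γ (λ r s → F (suc r) s)
  Recurrence-shiftˡ rec r s = rec (suc r) s

  Recurrence-shiftʳ : ∀ {α β γ F} → Recurrence α β γ F → Recurrence α β γ (λ r s → F r (suc s))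
  Recurrence-shiftʳ rec r s = rec r (suc s)

  Recurrence-transpose : ∀ {α β γ F} → Recurrence α β γ F → Recurrence β α γ (λ r s → F s r)
  Recurrence-transpose rec r s = trans (rec s r) (+-congʳ (+-comm _ _))

  Recurrence-+ : ∀ {α β γ F H} → Recurrence α β γ F → Recurrence α β γ H →
                 Recurrence α β γ (λ r s → F r s + H r s)
  Recurrence-+ {α} {β} {γ} recF recH r s =
    trans (+-cong (recF r s) (recH r s)) (collect α β γ _ _ _ _ _ _)
    where
    collect : ∀ α β γ a b c a′ b′ c′ →
              (α * a + β * b + γ * c) + (α * a′ + β * b′ + γ * c′) ≈
              α * (a + a′) + β * (b + b′) + γ * (c + c′)
    collect = solve 9 (λ α β γ a b c a′ b′ c′ →
      (α :* a :+ β :* b :+ γ :* c) :+ (α :* a′ :+ β :* b′ :+ γ :* c′) :=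
      α :* (a :+ a′) :+ β :* (b :+ b′) :+ γ :* (c :+ c′)) refl

  pow*pow-recurrence : ∀ {α β γ} x y → x * y ≈ α * x + β * y + γ →
                       Recurrence α β γ (λ r s → pow x r * pow y s)
  pow*pow-recurrence {α} {β} {γ} x y xy≈ r s = begin
    x * pow x r * (y * pow y s)                       ≈⟨ regroup x (pow x r) y (pow y s) ⟩
    x * y * (pow x r * pow y s)                       ≈⟨ *-congʳ xy≈ ⟩
    (α * x + β * y + γ) * (pow x r * pow y s)         ≈⟨ expand α β γ x y (pow x r) (pow y s) ⟩
    α * (x * pow x r * pow y s) + β * (pow x r * (y * pow y s)) + γ * (pow x r * pow y s) ∎
    where
    regroup : ∀ x X y Y → x * X * (y * Y) ≈ x * y * (X * Y)
    regroup = solve 4 (λ x X y Y → x :* X :* (y :* Y) := x :* y :* (X :* Y)) refl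
    expand : ∀ α β γ x y X Y →
             (α * x + β * y + γ) * (X * Y) ≈ α * (x * X * Y) + β * (X * (y * Y)) + γ * (X * Y)
    expand = solve 7 (λ α β γ x y X Y →
      (α :* x :+ β :* y :+ γ) :* (X :* Y) := α :* (x :* X :* Y) :+ β :* (X :* (y :* Y)) :+ γ :* (X :* Y)) refl

  Recurrence-unique : ∀ {α β γ F H} → Recurrence α β γ F → Recurrence α β γ H →
                      (∀ r → F r 0 ≈ H r 0) → (∀ s → F 0 s ≈ H 0 s) → ∀ r s → F r s ≈ H r s
  Recurrence-unique recF recH F≈Hʳ F≈Hˡ r zero = F≈Hʳ r
  Recurrence-unique recF recH F≈Hʳ F≈Hˡ zero (suc s) = F≈Hˡ (suc s)
  Recurrence-unique {F = F} {H = H} recF recH F≈Hʳ F≈Hˡ (suc r) (suc s) =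
    trans (recF r s) (trans (+-cong (+-cong (*-congˡ (unique (suc r) s)) (*-congˡ (unique r (suc s))))
                                    (*-congˡ (unique r s)))
                            (sym (recH r s)))
    where
    unique : ∀ r s → F r s ≈ H r s
    unique = Recurrence-unique recF recH F≈Hʳ F≈Hˡ

module Expansion {c ℓ : Level} (R : CommutativeRing c ℓ) (δ w : CommutativeRing.Carrier R) where
  open Over R
  open Arithmetic R
  open Recurrences R
  import Data.Nat.Properties as ℕ
  open import Relation.Binary.PropositionalEquality as ≡ using (_≡_)
  open import Relation.Nullary using (yes; no)
  open import Algebra.Solver.Ring.NaturalCoefficients.Default commutativeSemiring
  open import Relation.Binary.Reasoning.Setoid setoid

  -- The three sums of the theorem are G x P Q r (s − 1), G y Q P s (r − 1) and D P Q (r − 1) (s − 1),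
  -- see G-stated and D-stated; D runs over i < r instead of i < min r s, the extra terms being zero.
  gMono : Carrier → Carrier → Carrier → ℕ → ℕ → ℕ → ℕ → Carrier
  gMono X P Q t a b e = pow δ b * (pow P (t ℕ.∸ b) * pow Q a) * pow X e * pow w (suc t ℕ.+ a)

  gTerm : Carrier → Carrier → Carrier → ℕ → ℕ → ℕ → ℕ → Carrier
  gTerm X P Q t a b e = fromℕ (coeffG t a b) * gMono X P Q t a b e

  G : Carrier → Carrier → Carrier → ℕ → ℕ → Carrier
  G X P Q r t = Tri r (gTerm X P Q t)

  dMono : Carrier → Carrier → ℕ → ℕ → ℕ → Carrier
  dMono P Q r s i = pow δ (suc i) * (pow P (s ℕ.∸ i) * pow Q (r ℕ.∸ i)) * pow w (suc (r ℕ.+ s ℕ.∸ i))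

  dTerm : Carrier → Carrier → ℕ → ℕ → ℕ → Carrier
  dTerm P Q r s i = fromℕ (coeffD r s i) * dMono P Q r s i

  D : Carrier → Carrier → ℕ → ℕ → Carrier
  D P Q r s = sumTo (suc r) (dTerm P Q r s)

  gMono-P : ∀ X P Q t a b e → b ℕ.≤ t → gMono X P Q (suc t) a b e ≈ P * w * gMono X P Q t a b e
  gMono-P X P Q t a b e b≤t rewrite ℕ.+-∸-assoc 1 b≤t =
    regroup (pow δ b) P (pow P (t ℕ.∸ b)) (pow Q a) (pow X e) w (pow w (suc t ℕ.+ a))
    where
    regroup : ∀ d p pt qa x w wt → d * (p * pt * qa) * x * (w * wt) ≈ p * w * (d * (pt * qa) * x * wt)
    regroup = solve 7 (λ d p pt qa x w wt →
      d :* (p :* pt :* qa) :* x :* (w :* wt) := p :* w :* (d :* (pt :* qa) :* x :* wt)) refl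

  gMono-δ : ∀ X P Q t a b e → gMono X P Q (suc t) a (suc b) e ≈ δ * w * gMono X P Q t a b e
  gMono-δ X P Q t a b e = regroup δ (pow δ b) (pow P (t ℕ.∸ b) * pow Q a) (pow X e) w (pow w (suc t ℕ.+ a))
    where
    regroup : ∀ d db pq x w wt → d * db * pq * x * (w * wt) ≈ d * w * (db * pq * x * wt)
    regroup = solve 6 (λ d db pq x w wt → d :* db :* pq :* x :* (w :* wt) := d :* w :* (db :* pq :* x :* wt)) refl

  gMono-Q : ∀ X P Q t a b e → gMono X P Q t (suc a) b e ≈ Q * w * gMono X P Q t a b e
  gMono-Q X P Q t a b e rewrite ℕ.+-suc t a =
    regroup (pow δ b) (pow P (t ℕ.∸ b)) Q (pow Q a) (pow X e) w (pow w (suc t ℕ.+ a))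
    where
    regroup : ∀ d pt q qa x w wt → d * (pt * (q * qa)) * x * (w * wt) ≈ q * w * (d * (pt * qa) * x * wt)
    regroup = solve 7 (λ d pt q qa x w wt →
      d :* (pt :* (q :* qa)) :* x :* (w :* wt) := q :* w :* (d :* (pt :* qa) :* x :* wt)) refl

  G-recurrence : ∀ X P Q → Recurrence (P * w) (Q * w) (δ * w) (G X P Q)
  G-recurrence X P Q r t = begin
    Tri (suc r) (gTerm X P Q (suc t))
      ≈⟨ Tri-cong (suc r) (λ a b e → coefficient-split (coeffG t a b) (shift (coeffG t a) b)
                                    (shift (λ a → coeffG (suc t) a b) a) _ (coeffG-pascal t a b)) ⟩
    Tri (suc r) (λ a b e → keep a b e + dropᵇ a b e + dropᵃ a b e)
      ≈⟨ trans (Tri-+ (suc r) _ dropᵃ) (+-congʳ (Tri-+ (suc r) keep dropᵇ)) ⟩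
    Tri (suc r) keep + Tri (suc r) dropᵇ + Tri (suc r) dropᵃ
      ≈⟨ +-cong (+-cong keep-sum dropᵇ-sum) dropᵃ-sum ⟩
    P * w * G X P Q (suc r) t + δ * w * G X P Q r t + Q * w * G X P Q r (suc t)
      ≈⟨ swap _ _ _ ⟩
    P * w * G X P Q (suc r) t + Q * w * G X P Q r (suc t) + δ * w * G X P Q r t ∎
    where
    keep dropᵇ dropᵃ : ℕ → ℕ → ℕ → Carrier
    keep  a b e = fromℕ (coeffG t a b) * gMono X P Q (suc t) a b e
    dropᵇ a b e = fromℕ (shift (coeffG t a) b) * gMono X P Q (suc t) a b e
    dropᵃ a b e = fromℕ (shift (λ a → coeffG (suc t) a b) a) * gMono X P Q (suc t) a b e

    keep-term : ∀ a b e → keep a b e ≈ P * w * gTerm X P Q t a b e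
    keep-term a b e with b ℕ.≤? t
    ... | yes b≤t = pull-factor _ _ (gMono-P X P Q t a b e b≤t)
    ... | no b≰t  = pull-factor-vanishing _ _ _ (coeffG-vanish a (ℕ.≰⇒> b≰t))

    keep-sum : Tri (suc r) keep ≈ P * w * G X P Q (suc r) t
    keep-sum = trans (Tri-cong (suc r) keep-term) (sym (*-distribˡ-Tri (suc r) _ _))

    dropᵇ-sum : Tri (suc r) dropᵇ ≈ δ * w * G X P Q r t
    dropᵇ-sum = trans (Tri-dropᵇ r dropᵇ (λ a e → zeroˡ _))
      (trans (Tri-cong r (λ a b e → pull-factor _ _ (gMono-δ X P Q t a b e))) (sym (*-distribˡ-Tri r _ _)))

    dropᵃ-sum : Tri (suc r) dropᵃ ≈ Q * w * G X P Q r (suc t)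
    dropᵃ-sum = trans (Tri-dropᵃ r dropᵃ (λ b e → zeroˡ _))
      (trans (Tri-cong r (λ a b e → pull-factor _ _ (gMono-Q X P Q (suc t) a b e))) (sym (*-distribˡ-Tri r _ _)))

    swap : ∀ x y z → x + y + z ≈ x + z + y
    swap = solve 3 (λ x y z → x :+ y :+ z := x :+ z :+ y) refl

  dMono-P : ∀ P Q p t i → i ℕ.≤ t → dMono P Q (suc p) (suc t) i ≈ P * w * dMono P Q (suc p) t i
  dMono-P P Q p t i i≤t
    rewrite ℕ.+-suc (suc p) t | ℕ.+-∸-assoc 1 (ℕ.m≤n⇒m≤o+n (suc p) i≤t) | ℕ.+-∸-assoc 1 i≤t =
    regroup (pow δ (suc i)) P (pow P (t ℕ.∸ i)) (pow Q (suc p ℕ.∸ i)) w (pow w (suc p ℕ.+ t ℕ.∸ i))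
    where
    regroup : ∀ d p pt q w wt → d * (p * pt * q) * (w * (w * wt)) ≈ p * w * (d * (pt * q) * (w * wt))
    regroup = solve 6 (λ d p pt q w wt →
      d :* (p :* pt :* q) :* (w :* (w :* wt)) := p :* w :* (d :* (pt :* q) :* (w :* wt))) refl

  dMono-Q : ∀ P Q p t i → i ℕ.≤ p → dMono P Q (suc p) (suc t) i ≈ Q * w * dMono P Q p (suc t) i
  dMono-Q P Q p t i i≤p rewrite ℕ.+-∸-assoc 1 (ℕ.m≤n⇒m≤n+o (suc t) i≤p) | ℕ.+-∸-assoc 1 i≤p =
    regroup (pow δ (suc i)) (pow P (suc t ℕ.∸ i)) Q (pow Q (p ℕ.∸ i)) w (pow w (p ℕ.+ suc t ℕ.∸ i))
    where
    regroup : ∀ d pt q qt w wt → d * (pt * (q * qt)) * (w * (w * wt)) ≈ q * w * (d * (pt * qt) * (w * wt))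
    regroup = solve 6 (λ d pt q qt w wt →
      d :* (pt :* (q :* qt)) :* (w :* (w :* wt)) := q :* w :* (d :* (pt :* qt) :* (w :* wt))) refl

  dMono-δ : ∀ P Q p t j → j ℕ.≤ p → dMono P Q (suc p) (suc t) (suc j) ≈ δ * w * dMono P Q p t j
  dMono-δ P Q p t j j≤p rewrite ℕ.+-suc p t | ℕ.+-∸-assoc 1 (ℕ.m≤n⇒m≤n+o t j≤p) =
    regroup δ (pow δ (suc j)) (pow P (t ℕ.∸ j) * pow Q (p ℕ.∸ j)) w (pow w (suc (p ℕ.+ t ℕ.∸ j)))
    where
    regroup : ∀ d dj pq w wt → d * dj * pq * (w * wt) ≈ d * w * (dj * pq * wt)
    regroup = solve 5 (λ d dj pq w wt → d :* dj :* pq :* (w :* wt) := d :* w :* (dj :* pq :* wt)) refl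

  D-recurrence : ∀ P Q → Recurrence (P * w) (Q * w) (δ * w) (D P Q)
  D-recurrence P Q p t = begin
    sumTo (suc (suc p)) (dTerm P Q (suc p) (suc t))
      ≈⟨ sumTo-cong (suc (suc p)) (λ i → coefficient-split (coeffD (suc p) t i) (coeffD p (suc t) i)
                                             (shift (coeffD p t) i) _ (coeffD-pascal p t i)) ⟩
    sumTo (suc (suc p)) (λ i → keepᵖ i + keepᵗ i + drop i)
      ≈⟨ trans (sumTo-+ (suc (suc p)) _ drop) (+-congʳ (sumTo-+ (suc (suc p)) keepᵖ keepᵗ)) ⟩
    sumTo (suc (suc p)) keepᵖ + sumTo (suc (suc p)) keepᵗ + sumTo (suc (suc p)) drop
      ≈⟨ +-cong (+-cong keepᵖ-sum keepᵗ-sum) drop-sum ⟩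
    P * w * D P Q (suc p) t + Q * w * D P Q p (suc t) + δ * w * D P Q p t ∎
    where
    M : ℕ → Carrier
    M = dMono P Q (suc p) (suc t)
    keepᵖ keepᵗ drop : ℕ → Carrier
    keepᵖ i = fromℕ (coeffD (suc p) t i) * M i
    keepᵗ i = fromℕ (coeffD p (suc t) i) * M i
    drop  i = fromℕ (shift (coeffD p t) i) * M i

    keepᵖ-term : ∀ i → keepᵖ i ≈ P * w * dTerm P Q (suc p) t i
    keepᵖ-term i with i ℕ.≤? t
    ... | yes i≤t = pull-factor _ _ (dMono-P P Q p t i i≤t)
    ... | no i≰t  = pull-factor-vanishing _ _ _ (coeffD-vanishʳ (suc p) (ℕ.≰⇒> i≰t))

    keepᵗ-term : ∀ i → keepᵗ i ≈ Q * w * dTerm P Q p (suc t) i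
    keepᵗ-term i with i ℕ.≤? p
    ... | yes i≤p = pull-factor _ _ (dMono-Q P Q p t i i≤p)
    ... | no i≰p  = pull-factor-vanishing _ _ _ (coeffD-vanishˡ (suc t) (ℕ.≰⇒> i≰p))

    drop-term : ∀ j → drop (suc j) ≈ δ * w * dTerm P Q p t j
    drop-term j with j ℕ.≤? p
    ... | yes j≤p = pull-factor _ _ (dMono-δ P Q p t j j≤p)
    ... | no j≰p  = pull-factor-vanishing _ _ _ (coeffD-vanishˡ t (ℕ.≰⇒> j≰p))

    keepᵖ-sum : sumTo (suc (suc p)) keepᵖ ≈ P * w * D P Q (suc p) t
    keepᵖ-sum = trans (sumTo-cong (suc (suc p)) keepᵖ-term) (sym (*-distribˡ-sumTo (suc (suc p)) _ _))

    keepᵗ-sum : sumTo (suc (suc p)) keepᵗ ≈ Q * w * D P Q p (suc t)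
    keepᵗ-sum = begin
      sumTo (suc (suc p)) keepᵗ                          ≈⟨ sumTo-cong (suc (suc p)) keepᵗ-term ⟩
      sumTo (suc (suc p)) (λ i → Q * w * dTerm P Q p (suc t) i) ≈⟨ *-distribˡ-sumTo (suc (suc p)) _ _ ⟨
      Q * w * sumTo (suc (suc p)) (dTerm P Q p (suc t))
        ≈⟨ *-congˡ (sumTo-extend (suc (suc p)) _ (ℕ.n≤1+n (suc p)) beyond-p) ⟩
      Q * w * D P Q p (suc t)                            ∎
      where
      beyond-p : ∀ i → suc p ℕ.≤ i → i ℕ.< suc (suc p) → dTerm P Q p (suc t) i ≈ 0#
      beyond-p i p<i _ = zero-coefficient _ (coeffD-vanishˡ (suc t) p<i)

    drop-sum : sumTo (suc (suc p)) drop ≈ δ * w * D P Q p t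
    drop-sum = begin
      sumTo (suc (suc p)) drop                           ≈⟨ sumTo-suc-head (suc p) drop ⟩
      drop 0 + sumTo (suc p) (λ j → drop (suc j))        ≈⟨ trans (+-congʳ (zeroˡ _)) (+-identityˡ _) ⟩
      sumTo (suc p) (λ j → drop (suc j))                 ≈⟨ sumTo-cong (suc p) drop-term ⟩
      sumTo (suc p) (λ j → δ * w * dTerm P Q p t j)      ≈⟨ *-distribˡ-sumTo (suc p) _ _ ⟨
      δ * w * D P Q p t                                  ∎

  geometric-term : Carrier → Carrier → ℕ → ℕ → Carrier
  geometric-term X Q n a = pow Q a * pow X (suc n ℕ.∸ a) * pow w (suc a)

  G-zeroʳ : ∀ X P Q n → G X P Q (suc n) 0 ≈ sumTo (suc n) (geometric-term X Q n)
  G-zeroʳ X P Q n =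
    trans (Tri-first-row n (gTerm X P Q 0) (λ a b e → zero-coefficient _ (coeffG-vanish {b = suc b} a (ℕ.s≤s ℕ.z≤n))))
          (sumTo-cong (suc n) (λ a → trans (*-congʳ (fromℕ≈1 (coeffG[0,a,0]≡1 a))) (simplify _ _ _)))
    where
    simplify : ∀ qa x wa → 1# * (1# * (1# * qa) * x * wa) ≈ qa * x * wa
    simplify = solve 3 (λ qa x wa → con 1 :* (con 1 :* (con 1 :* qa) :* x :* wa) := qa :* x :* wa) refl

  G-oneˡ : ∀ X P Q n → G X P Q 1 n ≈ pow P n * X * pow w (suc n)
  G-oneˡ X P Q n = trans (Tri-one (gTerm X P Q n))
    (trans (simplify _ _ _) (*-congˡ (reflexive (≡.cong (λ m → pow w (suc m)) (ℕ.+-identityʳ n)))))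
    where
    simplify : ∀ pn x wn → (1# + 0#) * (1# * (pn * 1#) * (x * 1#) * wn) ≈ pn * x * wn
    simplify = solve 3 (λ pn x wn → (con 1 :+ con 0) :* (con 1 :* (pn :* con 1) :* (x :* con 1) :* wn) := pn :* x :* wn) refl

  D-zeroʳ : ∀ P Q r → D P Q r 0 ≈ δ * pow Q r * pow w (suc r)
  D-zeroʳ P Q r = begin
    sumTo (suc r) (dTerm P Q r 0)
      ≈⟨ sumTo-extend (suc r) _ (ℕ.s≤s ℕ.z≤n) (λ i 0<i _ → zero-coefficient _ (coeffD-vanishʳ r 0<i)) ⟩
    0# + dTerm P Q r 0 0
      ≈⟨ +-identityˡ _ ⟩
    dTerm P Q r 0 0
      ≈⟨ *-congʳ (fromℕ≈1 (coeffD[r,0,0]≡1 r)) ⟩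
    1# * dMono P Q r 0 0
      ≈⟨ trans (simplify _ _ _) (*-congˡ (reflexive (≡.cong (λ n → pow w (suc n)) (ℕ.+-identityʳ r)))) ⟩
    δ * pow Q r * pow w (suc r) ∎
    where
    simplify : ∀ d qr wr → 1# * (d * 1# * (1# * qr) * wr) ≈ d * qr * wr
    simplify = solve 3 (λ d qr wr → con 1 :* (d :* con 1 :* (con 1 :* qr) :* wr) := d :* qr :* wr) refl

  D-zeroˡ : ∀ P Q s → D P Q 0 s ≈ δ * pow P s * pow w (suc s)
  D-zeroˡ P Q s = trans (+-identityˡ _) (simplify _ _ _)
    where
    simplify : ∀ d ps ws → (1# + 0#) * (d * 1# * (ps * 1#) * ws) ≈ d * ps * ws
    simplify = solve 3 (λ d ps ws → (con 1 :+ con 0) :* (d :* con 1 :* (ps :* con 1) :* ws) := d :* ps :* ws) refl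

  geometric-expansion : ∀ X Y Q → X * Y ≈ w * (X + Q * Y) → ∀ n →
    pow X (suc n) * Y ≈ sumTo (suc n) (geometric-term X Q n) + pow Q (suc n) * Y * pow w (suc n)
  geometric-expansion X Y Q XY≈ zero = trans (simplify X Y) (trans XY≈ (expand X Y Q w))
    where
    simplify : ∀ X Y → X * 1# * Y ≈ X * Y
    simplify = solve 2 (λ X Y → X :* con 1 :* Y := X :* Y) refl
    expand : ∀ X Y Q w → w * (X + Q * Y) ≈ 0# + 1# * (X * 1#) * (w * 1#) + Q * 1# * Y * (w * 1#)
    expand = solve 4 (λ X Y Q w →
      w :* (X :+ Q :* Y) := con 0 :+ con 1 :* (X :* con 1) :* (w :* con 1) :+ Q :* con 1 :* Y :* (w :* con 1)) refl
  geometric-expansion X Y Q XY≈ (suc n) = begin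
    X * pow X (suc n) * Y
      ≈⟨ *-assoc _ _ _ ⟩
    X * (pow X (suc n) * Y)
      ≈⟨ *-congˡ (geometric-expansion X Y Q XY≈ n) ⟩
    X * (S + Qⁿ * Y * Wⁿ)
      ≈⟨ distribute X S Qⁿ Y Wⁿ ⟩
    X * S + Qⁿ * Wⁿ * (X * Y)
      ≈⟨ +-congˡ (*-congˡ XY≈) ⟩
    X * S + Qⁿ * Wⁿ * (w * (X + Q * Y))
      ≈⟨ expand (X * S) Qⁿ Wⁿ w X Q Y ⟩
    X * S + Qⁿ * X * (w * Wⁿ) + Q * Qⁿ * Y * (w * Wⁿ)
      ≈⟨ +-congʳ (+-cong X*S last-term) ⟩
    sumTo (suc (suc n)) (geometric-term X Q (suc n)) + pow Q (suc (suc n)) * Y * pow w (suc (suc n)) ∎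
    where
    S Qⁿ Wⁿ : Carrier
    S  = sumTo (suc n) (geometric-term X Q n)
    Qⁿ = pow Q (suc n)
    Wⁿ = pow w (suc n)
    distribute : ∀ X S Qⁿ Y Wⁿ → X * (S + Qⁿ * Y * Wⁿ) ≈ X * S + Qⁿ * Wⁿ * (X * Y)
    distribute = solve 5 (λ X S Qⁿ Y Wⁿ → X :* (S :+ Qⁿ :* Y :* Wⁿ) := X :* S :+ Qⁿ :* Wⁿ :* (X :* Y)) refl
    expand : ∀ XS Qⁿ Wⁿ w X Q Y →
             XS + Qⁿ * Wⁿ * (w * (X + Q * Y)) ≈ XS + Qⁿ * X * (w * Wⁿ) + Q * Qⁿ * Y * (w * Wⁿ)
    expand = solve 7 (λ XS Qⁿ Wⁿ w X Q Y →
      XS :+ Qⁿ :* Wⁿ :* (w :* (X :+ Q :* Y)) := XS :+ Qⁿ :* X :* (w :* Wⁿ) :+ Q :* Qⁿ :* Y :* (w :* Wⁿ)) refl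
    X*term : ∀ a → a ℕ.≤ suc n → X * geometric-term X Q n a ≈ geometric-term X Q (suc n) a
    X*term a a≤1+n rewrite ℕ.+-∸-assoc 1 a≤1+n = regroup X (pow Q a) (pow X (suc n ℕ.∸ a)) (pow w (suc a))
      where
      regroup : ∀ X qa x wa → X * (qa * x * wa) ≈ qa * (X * x) * wa
      regroup = solve 4 (λ X qa x wa → X :* (qa :* x :* wa) := qa :* (X :* x) :* wa) refl
    X*S : X * S ≈ sumTo (suc n) (geometric-term X Q (suc n))
    X*S = trans (*-distribˡ-sumTo (suc n) X _) (sumTo-cong-< (suc n) (λ a a<2+n → X*term a (ℕ.<⇒≤ a<2+n)))
    last-term : Qⁿ * X * (w * Wⁿ) ≈ geometric-term X Q (suc n) (suc n)
    last-term rewrite ℕ.m+n∸n≡m 1 n = *-congʳ (*-congˡ (sym (*-identityʳ X)))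

  expansion-base : ∀ X Y P Q → X * Y ≈ w * (X + Q * Y) → Q * Y + δ ≈ Y → ∀ n →
    pow X (suc n) * Y + δ * pow Q n * pow w (suc n) ≈ G X P Q (suc n) 0 + G Y Q P 1 n
  expansion-base X Y P Q XY≈ QY+δ≈Y n = begin
    pow X (suc n) * Y + δ * pow Q n * Wⁿ
      ≈⟨ +-congʳ (geometric-expansion X Y Q XY≈ n) ⟩
    S + Q * pow Q n * Y * Wⁿ + δ * pow Q n * Wⁿ
      ≈⟨ factor S Q (pow Q n) Y Wⁿ δ ⟩
    S + pow Q n * (Q * Y + δ) * Wⁿ
      ≈⟨ +-congˡ (*-congʳ (*-congˡ QY+δ≈Y)) ⟩
    S + pow Q n * Y * Wⁿ
      ≈⟨ +-cong (G-zeroʳ X P Q n) (G-oneˡ Y Q P n) ⟨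
    G X P Q (suc n) 0 + G Y Q P 1 n ∎
    where
    S Wⁿ : Carrier
    S = sumTo (suc n) (geometric-term X Q n)
    Wⁿ = pow w (suc n)
    factor : ∀ S Q Qⁿ Y W d → S + Q * Qⁿ * Y * W + d * Qⁿ * W ≈ S + Qⁿ * (Q * Y + d) * W
    factor = solve 6 (λ S Q Qⁿ Y W d → S :+ Q :* Qⁿ :* Y :* W :+ d :* Qⁿ :* W := S :+ Qⁿ :* (Q :* Y :+ d) :* W) refl

  module _ (x y P Q : Carrier) (Px+δ≈x : P * x + δ ≈ x) (Qy+δ≈y : Q * y + δ ≈ y)
           (xy≈ : x * y ≈ w * (x + Q * y)) where

    expansion : ∀ r s → pow x (suc r) * pow y (suc s) + D P Q r s ≈ G x P Q (suc r) s + G y Q P (suc s) r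
    expansion = Recurrence-unique
      (Recurrence-+ (Recurrence-shiftˡ (Recurrence-shiftʳ (pow*pow-recurrence x y xy-recurrence)))
                    (D-recurrence P Q))
      (Recurrence-+ (Recurrence-shiftˡ (G-recurrence x P Q))
                    (Recurrence-transpose (Recurrence-shiftˡ (G-recurrence y Q P))))
      boundaryʳ boundaryˡ
      where
      xy-recurrence : x * y ≈ P * w * x + Q * w * y + δ * w
      xy-recurrence = trans xy≈ (trans (*-congˡ (+-congʳ (sym Px+δ≈x))) (expand w P x δ Q y))
        where
        expand : ∀ w P x d Q y → w * (P * x + d + Q * y) ≈ P * w * x + Q * w * y + d * w
        expand = solve 6 (λ w P x d Q y → w :* (P :* x :+ d :+ Q :* y) := P :* w :* x :+ Q :* w :* y :+ d :* w) refl

      yx≈ : y * x ≈ w * (y + P * x)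
      yx≈ = trans (*-comm y x) (trans xy≈ (*-congˡ (begin
        x + Q * y             ≈⟨ +-congʳ (sym Px+δ≈x) ⟩
        P * x + δ + Q * y     ≈⟨ rearrange (P * x) δ (Q * y) ⟩
        Q * y + δ + P * x     ≈⟨ +-congʳ Qy+δ≈y ⟩
        y + P * x             ∎)))
        where
        rearrange : ∀ a d b → a + d + b ≈ b + d + a
        rearrange = solve 3 (λ a d b → a :+ d :+ b := b :+ d :+ a) refl

      boundaryʳ : ∀ r → pow x (suc r) * pow y 1 + D P Q r 0 ≈ G x P Q (suc r) 0 + G y Q P 1 r
      boundaryʳ r = trans (+-cong (*-congˡ (*-identityʳ y)) (D-zeroʳ P Q r)) (expansion-base x y P Q xy≈ Qy+δ≈y r)

      boundaryˡ : ∀ s → pow x 1 * pow y (suc s) + D P Q 0 s ≈ G x P Q 1 s + G y Q P (suc s) 0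
      boundaryˡ s = trans (+-cong (trans (*-comm _ _) (*-congˡ (*-identityʳ x))) (D-zeroˡ P Q s))
                          (trans (expansion-base y x Q P yx≈ Px+δ≈x s) (+-comm _ _))

  G-stated : ∀ X A B r t (E : ℕ → ℕ → Carrier) → (∀ m n → pow A m * pow B n ≈ E m n) →
    G X A B r t ≈ sumTo r (λ a → sumTo (r ℕ.∸ a) (λ b →
                    fromℕ (trinom (a ℕ.+ suc t ℕ.∸ 1) a b) * pow δ b * E (t ℕ.∸ b) a
                    * pow X (r ℕ.∸ a ℕ.∸ b) * pow w (suc t ℕ.+ a)))
  G-stated X A B r t E AB≈E =
    trans (Tri-unfold r (gTerm X A B t))
          (sumTo-cong r (λ a → sumTo-cong (r ℕ.∸ a) (λ b → stated-term a b (r ℕ.∸ a ℕ.∸ b))))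
    where
    reassociate : ∀ k d p x v → k * (d * p * x * v) ≈ k * d * p * x * v
    reassociate = solve 5 (λ k d p x v → k :* (d :* p :* x :* v) := k :* d :* p :* x :* v) refl
    stated-term : ∀ a b n → gTerm X A B t a b n ≈
      fromℕ (trinom (a ℕ.+ suc t ℕ.∸ 1) a b) * pow δ b * E (t ℕ.∸ b) a * pow X n * pow w (suc t ℕ.+ a)
    stated-term a b n =
      trans (*-cong (reflexive (≡.cong fromℕ (≡.sym (trinom≡coeffG t a b)))) (*-congʳ (*-congʳ (*-congˡ (AB≈E _ _)))))
            (reassociate _ _ _ _ _)

  D-stated : ∀ A B r s (E : ℕ → ℕ → Carrier) → (∀ m n → pow A m * pow B n ≈ E m n) →
    D A B r s ≈ sumTo (suc r ⊓ suc s) (λ i →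
                  fromℕ (trinom (suc r ℕ.+ suc s ℕ.∸ (i ℕ.+ 1) ℕ.∸ 1) (suc r ℕ.∸ (i ℕ.+ 1)) (suc s ℕ.∸ (i ℕ.+ 1)))
                  * pow δ (i ℕ.+ 1) * E (suc s ℕ.∸ (i ℕ.+ 1)) (suc r ℕ.∸ (i ℕ.+ 1))
                  * pow w (suc r ℕ.+ suc s ℕ.∸ (i ℕ.+ 1)))
  D-stated A B r s E AB≈E =
    trans (sumTo-extend (suc r) _ (ℕ.s≤s (ℕ.m⊓n≤m r s)) beyond-r⊓s)
          (sumTo-cong-< (suc (r ⊓ s)) (λ i i<1+r⊓s → stated-term i (ℕ.≤-pred i<1+r⊓s)))
    where
    beyond-r⊓s : ∀ i → suc (r ⊓ s) ℕ.≤ i → i ℕ.< suc r → dTerm A B r s i ≈ 0#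
    beyond-r⊓s i r⊓s<i i<1+r = zero-coefficient _ (coeffD-vanishʳ r s<i)
      where
      s<i : s ℕ.< i
      s<i = ℕ.≰⇒> (λ i≤s → ℕ.<⇒≱ r⊓s<i (ℕ.⊓-glb (ℕ.≤-pred i<1+r) i≤s))

    stated-term : ∀ i → i ℕ.≤ r ⊓ s → dTerm A B r s i ≈
      fromℕ (trinom (suc r ℕ.+ suc s ℕ.∸ (i ℕ.+ 1) ℕ.∸ 1) (suc r ℕ.∸ (i ℕ.+ 1)) (suc s ℕ.∸ (i ℕ.+ 1)))
      * pow δ (i ℕ.+ 1) * E (suc s ℕ.∸ (i ℕ.+ 1)) (suc r ℕ.∸ (i ℕ.+ 1)) * pow w (suc r ℕ.+ suc s ℕ.∸ (i ℕ.+ 1))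
    stated-term i i≤r⊓s rewrite ℕ.+-comm i 1 = sym (begin
      fromℕ (trinom (r ℕ.+ suc s ℕ.∸ i ℕ.∸ 1) (r ℕ.∸ i) (s ℕ.∸ i)) * pow δ (suc i) * E (s ℕ.∸ i) (r ℕ.∸ i)
        * pow w (r ℕ.+ suc s ℕ.∸ i)
        ≈⟨ reflexive (≡.cong₂ (λ k n → fromℕ k * pow δ (suc i) * E (s ℕ.∸ i) (r ℕ.∸ i) * pow w n) coefficient≡ top≡) ⟩
      fromℕ (coeffD r s i) * pow δ (suc i) * E (s ℕ.∸ i) (r ℕ.∸ i) * pow w (suc (r ℕ.+ s ℕ.∸ i))
        ≈⟨ *-congʳ (*-congˡ (sym (AB≈E (s ℕ.∸ i) (r ℕ.∸ i)))) ⟩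
      fromℕ (coeffD r s i) * pow δ (suc i) * (pow A (s ℕ.∸ i) * pow B (r ℕ.∸ i)) * pow w (suc (r ℕ.+ s ℕ.∸ i))
        ≈⟨ reassociate _ _ _ _ ⟩
      dTerm A B r s i ∎)
      where
      i≤r : i ℕ.≤ r
      i≤r = ℕ.≤-trans i≤r⊓s (ℕ.m⊓n≤m r s)
      i≤s : i ℕ.≤ s
      i≤s = ℕ.≤-trans i≤r⊓s (ℕ.m⊓n≤n r s)
      top≡ : r ℕ.+ suc s ℕ.∸ i ≡ suc (r ℕ.+ s ℕ.∸ i)
      top≡ = r+[1+s]∸i≡1+[r+s∸i] (ℕ.≤-trans i≤r (ℕ.m≤m+n r s))
      coefficient≡ : trinom (r ℕ.+ suc s ℕ.∸ i ℕ.∸ 1) (r ℕ.∸ i) (s ℕ.∸ i) ≡ coeffD r s i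
      coefficient≡ =
        ≡.trans (≡.cong (λ n → trinom (n ℕ.∸ 1) (r ℕ.∸ i) (s ℕ.∸ i)) top≡) (trinom≡coeffD′ i≤r i≤s)
      reassociate : ∀ k d m v → k * d * m * v ≈ k * (d * m * v)
      reassociate = solve 4 (λ k d m v → k :* d :* m :* v := k :* (d :* m :* v)) refl

lemma1 : {c ℓ : Level} (R : CommutativeRing c ℓ) →
    let open Over R in
    (q : Carrier) (r s u v : ℕ) →
       1 ℕ.≤ r → 1 ℕ.≤ s → 1 ℕ.≤ u → 1 ℕ.≤ v →
       (iu iv iw : Carrier) →
       qint q u * iu ≈ 1# → qint q v * iv ≈ 1# → qint q (u ℕ.+ v) * iw ≈ 1# →
       pow iu r * pow iv s ≈
         ((sumTo r (λ a → sumTo (r ℕ.∸ a) (λ b →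
              fromℕ (trinom (a ℕ.+ s ℕ.∸ 1) a b)
              * pow (1# - q) b
              * pow q ((s ℕ.∸ 1 ℕ.∸ b) ℕ.* u ℕ.+ a ℕ.* v)
              * pow iu (r ℕ.∸ a ℕ.∸ b)
              * pow iw (s ℕ.+ a)))
          + sumTo s (λ a → sumTo (s ℕ.∸ a) (λ b →
              fromℕ (trinom (a ℕ.+ r ℕ.∸ 1) a b)
              * pow (1# - q) b
              * pow q (a ℕ.* u ℕ.+ (r ℕ.∸ 1 ℕ.∸ b) ℕ.* v)
              * pow iv (s ℕ.∸ a ℕ.∸ b)
              * pow iw (r ℕ.+ a)))))
         - sumTo (r ⊓ s) (λ i →
              fromℕ (trinom (r ℕ.+ s ℕ.∸ (i ℕ.+ 1) ℕ.∸ 1) (r ℕ.∸ (i ℕ.+ 1)) (s ℕ.∸ (i ℕ.+ 1)))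
              * pow (1# - q) (i ℕ.+ 1)
              * pow q ((s ℕ.∸ (i ℕ.+ 1)) ℕ.* u ℕ.+ (r ℕ.∸ (i ℕ.+ 1)) ℕ.* v)
              * pow iw (r ℕ.+ s ℕ.∸ (i ℕ.+ 1)))
lemma1 R q zero    s       u v () _  _ _ iu iv iw [u]iu≈1 [v]iv≈1 [u+v]iw≈1
lemma1 R q (suc r) zero    u v _  () _ _ iu iv iw [u]iu≈1 [v]iv≈1 [u+v]iw≈1
lemma1 R q (suc r) (suc s) u v _  _  _ _ iu iv iw [u]iu≈1 [v]iv≈1 [u+v]iw≈1 = begin
  pow iu (suc r) * pow iv (suc s)                          ≈⟨ //-rightDividesʳ (D P Q r s) _ ⟨
  pow iu (suc r) * pow iv (suc s) + D P Q r s - D P Q r s  ≈⟨ +-congʳ expansion-at ⟩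
  G iu P Q (suc r) s + G iv Q P (suc s) r - D P Q r s
    ≈⟨ +-cong (+-cong (G-stated iu P Q (suc r) s _ pow-q)
                      (G-stated iv Q P (suc s) r _ (λ m n → trans (*-comm _ _) (pow-q n m))))
              (-‿cong (D-stated P Q r s _ pow-q)) ⟩
  _ ∎
  where
  open Over R
  open Arithmetic R using (pow-+; pow-*)
  open QIntegers R
  open Expansion R (1# - q) iw
  open import Algebra.Properties.Group +-group using (//-rightDividesʳ)
  open import Relation.Binary.Reasoning.Setoid setoid

  P Q : Carrier
  P = pow q u
  Q = pow q v

  pow-q : ∀ m n → pow P m * pow Q n ≈ pow q (m ℕ.* u ℕ.+ n ℕ.* v)
  pow-q m n = sym (trans (pow-+ q (m ℕ.* u) (n ℕ.* v)) (*-cong (pow-* q m u) (pow-* q n v)))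

  expansion-at : pow iu (suc r) * pow iv (suc s) + D P Q r s ≈ G iu P Q (suc r) s + G iv Q P (suc s) r
  expansion-at = expansion iu iv P Q (qⁿx+[1-q]≈x q u iu [u]iu≈1) (qⁿx+[1-q]≈x q v iv [v]iv≈1)
                           (xy≈w[x+qⁿy] q u v iu iv iw [u]iu≈1 [v]iv≈1 [u+v]iw≈1) r s
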